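{- Let $r\ge1$, $y\in X_{sp}(2r)$ and $z\in X_0^+(2r)$. The following are equivalent: (a) if $r$ is even, the pair $(y,z)$ satisfies $y_{2\rho-1}\ge z_{2\rho-1}\ge z_{2\rho}\ge y_{2\rho}$ for $\rho=1,\dots,r$; if $r$ is odd, the pair $(z,y)$ satisfies $z_{2\rho-1}\ge y_{2\rho-1}\ge y_{2\rho}\ge z_{2\rho}$ for $\rho=1,\dots,r$. (b) if $r$ is even, $\theta_i'(z)\prec\theta_i(y)$ for $i=1,2$; if $r$ is odd, $\theta_i'(y)\prec\theta_i(z)$ for $i=1,2$.
   Context: $X_0^+(2r)$ is the set of $x\in\mathbb{Z}^{2r}$ with $x_1\ge\dots\ge x_{2r}$ and $x_i+x_{2r+1-i}$ independent of $i$; $X_{sp}(2r)=\{x\in X_0^+(2r):x_r=x_{r+1}\}$. For $\alpha\in\mathbb{Z}^{r+1}$, $\beta\in\mathbb{Z}^r$, $\beta\prec\alpha$ means $\alpha_\rho\ge\beta_\rho\ge\alpha_{\rho+1}$ for $\rho=1,\dots,r$. Splitting maps ($\theta_i$ with values in $\mathbb{Z}^{r+1}$, $\theta'_i$ with values in $\mathbb{Z}^r$): for $r$ even and $y\in X_{sp}(2r)$, $z\in X_0^+(2r)$: $\theta_1(y)=(y_1,y_2,y_4,\dots,y_r,y_{r+3},y_{r+5},\dots,y_{2r-1},y_{2r})$, $\theta_2(y)=(y_1,y_3,\dots,y_{r-1},y_{r+1},y_{r+2},y_{r+4},\dots,y_{2r})$, $\theta'_1(z)=(z_2,z_4,\dots,z_r,z_{r+1},z_{r+3},\dots,z_{2r-1})$,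 $\theta'_2(z)=(z_1,z_3,\dots,z_{r-1},z_{r+2},z_{r+4},\dots,z_{2r})$. For $r$ odd and $z\in X_0^+(2r)$, $y\in X_{sp}(2r)$: $\theta_1(z)=(z_1,z_2,z_4,\dots,z_{r-1},z_{r+2},z_{r+4},\dots,z_{2r-1},z_{2r})$, $\theta_2(z)=(z_1,z_3,\dots,z_r,z_{r+1},z_{r+3},\dots,z_{2r})$, $\theta'_1(y)=(y_2,y_4,\dots,y_{r+1},y_{r+2},y_{r+4},\dots,y_{2r-1})$, $\theta'_2(y)=(y_1,y_3,\dots,y_r,y_{r+3},y_{r+5},\dots,y_{2r})$. In particular for $r=1$: $\theta_i(z)=z$ and $\theta'_i(y)=(y_1)$. -}

module Defs where

open import Data.Nat using (ℕ; zero; suc; _+_; _*_; _∸_; ⌊_/2⌋)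
open import Data.Nat.Base using (_≤ᵇ_; _≡ᵇ_)
open import Data.Bool using (if_then_else_)
open import Data.Integer using (ℤ; 0ℤ) renaming (_+_ to _+ℤ_; _≤_ to _≤ℤ_)
open import Data.Fin using (Fin; toℕ) renaming (zero to fzero; suc to fsuc)
open import Data.Product using (Σ; _×_)
open import Relation.Binary.PropositionalEquality using (_≡_)
import Data.Nat as N

-- Vectors x ∈ ℤ^n are functions Fin n → ℤ.
-- 1-based coordinate access: x ! i = x_i for 1 ≤ i ≤ n (junk value 0 otherwise;
-- never used out of range in the statement).
_!_ : ∀ {n} → (Fin n → ℤ) → ℕ → ℤ
_!_ {n} x zero = 0ℤ
_!_ {zero} x (suc i) = 0ℤ
_!_ {suc n} x (suc zero) = x fzero
_!_ {suc n} x (suc (suc i)) = (λ j → x (fsuc j)) ! suc i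

X0+ : (r : ℕ) → (Fin (2 * r) → ℤ) → Set
X0+ r x =
  (∀ i → 1 N.≤ i → i N.< 2 * r → x ! (suc i) ≤ℤ x ! i)
  × Σ ℤ (λ c → ∀ i → 1 N.≤ i → i N.≤ 2 * r → (x ! i) +ℤ (x ! (2 * r + 1 ∸ i)) ≡ c)

Xsp : (r : ℕ) → (Fin (2 * r) → ℤ) → Set
Xsp r x = X0+ r x × (x ! r ≡ x ! (r + 1))

_≺_ : ∀ {r} → (Fin r → ℤ) → (Fin (suc r) → ℤ) → Set
_≺_ {r} β α = ∀ ρ → 1 N.≤ ρ → ρ N.≤ r → (β ! ρ ≤ℤ α ! ρ) × (α ! (suc ρ) ≤ℤ β ! ρ)

select : ∀ {n} m → (ℕ → ℕ) → (Fin n → ℤ) → Fin m → ℤ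
select m idx x k = x ! idx (suc (toℕ k))

-- Index maps (1-based position k ↦ coordinate index), h = ⌊r/2⌋.
-- r even:
--  θ₁(y) = (y₁,y₂,y₄,…,y_r,y_{r+3},y_{r+5},…,y_{2r-1},y_{2r})
idxE1 : ℕ → ℕ → ℕ
idxE1 r k = if k ≡ᵇ 1 then 1 else
            (if k ≤ᵇ ⌊ r /2⌋ + 1 then 2 * k ∸ 2 else
            (if k ≤ᵇ r then 2 * k ∸ 1 else 2 * r))
--  θ₂(y) = (y₁,y₃,…,y_{r-1},y_{r+1},y_{r+2},y_{r+4},…,y_{2r})
idxE2 : ℕ → ℕ → ℕ
idxE2 r k = if k ≤ᵇ ⌊ r /2⌋ + 1 then 2 * k ∸ 1 else 2 * k ∸ 2
--  θ'₁(z) = (z₂,z₄,…,z_r,z_{r+1},z_{r+3},…,z_{2r-1})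
idxE1' : ℕ → ℕ → ℕ
idxE1' r k = if k ≤ᵇ ⌊ r /2⌋ then 2 * k else 2 * k ∸ 1
--  θ'₂(z) = (z₁,z₃,…,z_{r-1},z_{r+2},z_{r+4},…,z_{2r})
idxE2' : ℕ → ℕ → ℕ
idxE2' r k = if k ≤ᵇ ⌊ r /2⌋ then 2 * k ∸ 1 else 2 * k
-- r odd:
--  θ₁(z) = (z₁,z₂,z₄,…,z_{r-1},z_{r+2},z_{r+4},…,z_{2r-1},z_{2r})
idxO1 : ℕ → ℕ → ℕ
idxO1 r k = if k ≡ᵇ 1 then 1 else
            (if k ≤ᵇ ⌊ r /2⌋ + 1 then 2 * k ∸ 2 else
            (if k ≤ᵇ r then 2 * k ∸ 1 else 2 * r))
--  θ₂(z) = (z₁,z₃,…,z_r,z_{r+1},z_{r+3},…,z_{2r})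
idxO2 : ℕ → ℕ → ℕ
idxO2 r k = if k ≤ᵇ ⌊ r /2⌋ + 1 then 2 * k ∸ 1 else 2 * k ∸ 2
--  θ'₁(y) = (y₂,y₄,…,y_{r+1},y_{r+2},y_{r+4},…,y_{2r-1})
idxO1' : ℕ → ℕ → ℕ
idxO1' r k = if k ≤ᵇ ⌊ r /2⌋ + 1 then 2 * k else 2 * k ∸ 1
--  θ'₂(y) = (y₁,y₃,…,y_r,y_{r+3},y_{r+5},…,y_{2r})
idxO2' : ℕ → ℕ → ℕ
idxO2' r k = if k ≤ᵇ ⌊ r /2⌋ + 1 then 2 * k ∸ 1 else 2 * k

θ₁ θ₂ : (r : ℕ) → (Fin (2 * r) → ℤ) → Fin (suc r) → ℤ
θ₁ r x = if r N.% 2 ≡ᵇ 0 then select (suc r) (idxE1 r) x else select (suc r) (idxO1 r) x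
θ₂ r x = if r N.% 2 ≡ᵇ 0 then select (suc r) (idxE2 r) x else select (suc r) (idxO2 r) x

θ₁' θ₂' : (r : ℕ) → (Fin (2 * r) → ℤ) → Fin r → ℤ
θ₁' r x = if r N.% 2 ≡ᵇ 0 then select r (idxE1' r) x else select r (idxO1' r) x
θ₂' r x = if r N.% 2 ≡ᵇ 0 then select r (idxE2' r) x else select r (idxO2' r) x

Interlaced : (r : ℕ) → (u v : Fin (2 * r) → ℤ) → Set
Interlaced r u v = ∀ ρ → 1 N.≤ ρ → ρ N.≤ r →
  (v ! (2 * ρ ∸ 1) ≤ℤ u ! (2 * ρ ∸ 1)) × (v ! (2 * ρ) ≤ℤ v ! (2 * ρ ∸ 1)) × (u ! (2 * ρ) ≤ℤ v ! (2 * ρ))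

module Submission where

-- Write U for the vector whose entries are selected by θᵢ (U = y for r even,
-- U = z for r odd) and V for the other one.  Both are non-increasing, so
-- condition (a) reduces to: V ≤ U at every odd coordinate 2p+1 and U ≤ V at
-- every even coordinate 2p+2 (the middle inequalities of (a) are automatic).
-- Every comparison occurring in θ'ᵢ ≺ θᵢ compares U and V at two coordinates
-- enclosing such an odd (resp. even) coordinate ("windows"), hence follows from
-- (a) by monotonicity.  Conversely each odd and each even comparison of (a)
-- occurs literally in θ'₁ ≺ θ₁ or in θ'₂ ≺ θ₂ ("exposure"), except for one
-- pair of coordinates r, r+1 where the symplectic condition y_r = y_{r+1} is
-- needed.

open import Defs
open import Data.Nat using (ℕ; _≤_; _%_; _*_)
open import Data.Integer using (ℤ)
open import Data.Fin using (Fin)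
open import Data.Product using (_×_)
open import Function.Bundles using (_⇔_)
open import Relation.Binary.PropositionalEquality using (_≡_)

open import Data.Nat using (zero; suc; _+_; _∸_; _<_; ⌊_/2⌋; ⌈_/2⌉; z≤n; s≤s; _≤ᵇ_; _≡ᵇ_; _≤′_; ≤′-refl; ≤′-step)
open import Data.Nat.Properties
open import Data.Integer using () renaming (_≤_ to _≤ℤ_)
import Data.Integer.Properties as ℤ
open import Data.Bool using (Bool; true; false; if_then_else_)
open import Data.Unit using (tt)
open import Data.Fin using (toℕ)
open import Data.Product using (_,_; proj₁; proj₂)
open import Data.Product.Function.NonDependent.Propositional using (_×-⇔_)
open import Data.Sum using (_⊎_; inj₁; inj₂; [_,_])
open import Function using (_∘_)
open import Function.Bundles using (mk⇔)
open import Function.Construct.Composition using (_⇔-∘_)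
import Function.Properties.Equivalence as Equiv
open import Relation.Binary.Definitions using (tri<; tri≈; tri>)
open import Relation.Binary.PropositionalEquality using (refl; sym; trans; cong; subst; subst₂; module ≡-Reasoning)
open import Relation.Nullary using (yes; no; contradiction)

oddIx evenIx : ℕ → ℕ
oddIx p = suc (p + p)
evenIx p = suc (oddIx p)

double-suc : ∀ p → suc p + suc p ≡ evenIx p
double-suc p = cong suc (+-suc p p)

two-times : ∀ n → 2 * n ≡ n + n
two-times n = cong (n +_) (+-identityʳ n)

twice-suc : ∀ p → 2 * suc p ≡ evenIx p
twice-suc p = trans (two-times (suc p)) (double-suc p)

twice-suc∸1 : ∀ p → 2 * suc p ∸ 1 ≡ oddIx p
twice-suc∸1 p = cong (_∸ 1) (twice-suc p)

twice-suc∸2 : ∀ p → 2 * suc p ∸ 2 ≡ p + p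
twice-suc∸2 p = cong (_∸ 2) (twice-suc p)

evenIx<oddIx-suc : ∀ p → evenIx p < oddIx (suc p)
evenIx<oddIx-suc p = s≤s (s≤s (≤-reflexive (sym (+-suc p p))))

evenIx≤ : ∀ {p r} → p < r → evenIx p ≤ 2 * r
evenIx≤ {p} {r} p<r = subst₂ _≤_ (double-suc p) (sym (two-times r)) (+-mono-≤ p<r p<r)

oddIx≤ : ∀ {p r} → p < r → oddIx p ≤ 2 * r
oddIx≤ p<r = ≤-trans (n≤1+n _) (evenIx≤ p<r)

parity-split : ∀ r → r ≡ r % 2 + (⌊ r /2⌋ + ⌊ r /2⌋)
parity-split zero = refl
parity-split (suc zero) = refl
parity-split (suc (suc n)) = begin
  suc (suc n)                      ≡⟨ cong (suc ∘ suc) (parity-split n) ⟩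
  suc (suc (n % 2 + (h + h)))      ≡⟨ cong suc (sym (+-suc (n % 2) (h + h))) ⟩
  suc (n % 2 + suc (h + h))        ≡⟨ sym (+-suc (n % 2) (suc (h + h))) ⟩
  n % 2 + suc (suc (h + h))        ≡⟨ cong (λ k → n % 2 + suc k) (sym (+-suc h h)) ⟩
  n % 2 + (suc h + suc h)          ∎
  where
  open ≡-Reasoning
  h : ℕ
  h = ⌊ n /2⌋

even-split : ∀ r → r % 2 ≡ 0 → r ≡ ⌊ r /2⌋ + ⌊ r /2⌋
even-split r e = trans (parity-split r) (cong (_+ (⌊ r /2⌋ + ⌊ r /2⌋)) e)

odd-split : ∀ r → r % 2 ≡ 1 → r ≡ suc (⌊ r /2⌋ + ⌊ r /2⌋)
odd-split r e = trans (parity-split r) (cong (_+ (⌊ r /2⌋ + ⌊ r /2⌋)) e)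

half-positive : ∀ {r h} → 1 ≤ r → r ≡ h + h → 1 ≤ h
half-positive {h = zero}  () refl
half-positive {h = suc _} _  _    = s≤s z≤n

Antitone : ℕ → (ℕ → ℤ) → Set
Antitone n W = ∀ i → 1 ≤ i → i < n → W (suc i) ≤ℤ W i

antitone-≤ : ∀ {n W i j} → Antitone n W → 1 ≤ i → i ≤ j → j ≤ n → W j ≤ℤ W i
antitone-≤ {n} {W} {i} anti 1≤i i≤j = go (≤⇒≤′ i≤j)
  where
  go : ∀ {j} → i ≤′ j → j ≤ n → W j ≤ℤ W i
  go ≤′-refl _ = ℤ.≤-refl
  go (≤′-step {j} i≤′j) 1+j≤n =
    ℤ.≤-trans (anti j (≤-trans 1≤i (≤′⇒≤ i≤′j)) 1+j≤n) (go i≤′j (≤-trans (n≤1+n j) 1+j≤n))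

-- The reduced form of condition (a): on the first r pairs of coordinates,
-- V is below U at odd coordinates and above U at even coordinates.
Alternating : ℕ → (U V : ℕ → ℤ) → Set
Alternating r U V =
  (∀ p → p < r → V (oddIx p) ≤ℤ U (oddIx p)) × (∀ p → p < r → U (evenIx p) ≤ℤ V (evenIx p))

-- β ≺ α for sequences indexed from 1, with positions p counted from 0:
-- α_{p+1} ≥ β_{p+1} ≥ α_{p+2} for p < m.
Interlaces : ℕ → (β α : ℕ → ℤ) → Set
Interlaces m β α = ∀ p → p < m → (β (suc p) ≤ℤ α (suc p)) × (α (suc (suc p)) ≤ℤ β (suc p))

OuterWindow : ℕ → (ℕ → ℕ) → Set
OuterWindow r ia = ∀ p → p < r →
  ((1 ≤ ia (suc p)) × (ia (suc p) ≤ oddIx p)) × ((evenIx p ≤ ia (suc (suc p))) × (ia (suc (suc p)) ≤ 2 * r))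

Between : ℕ → ℕ → Set
Between p k = (oddIx p ≤ k) × (k ≤ evenIx p)

InnerWindow : (ℕ → ℕ) → Set
InnerWindow ib = ∀ p → Between p (ib (suc p))

odd-between : ∀ p → Between p (2 * suc p ∸ 1)
odd-between p = subst (Between p) (sym (twice-suc∸1 p)) (≤-refl , n≤1+n _)

even-between : ∀ p → Between p (2 * suc p)
even-between p = subst (Between p) (sym (twice-suc p)) (n≤1+n _ , ≤-refl)

-- Position p of β ≺ α reads V_{2p+1} ≤ U_{2p+1} (first inequality), resp.
-- U_{2p+2} ≤ V_{2p+2} (second inequality), up to equal values.
ExposesOdd ExposesEven : (U V : ℕ → ℤ) (ia ib : ℕ → ℕ) → ℕ → Set
ExposesOdd U V ia ib p = (V (ib (suc p)) ≡ V (oddIx p)) × (U (ia (suc p)) ≡ U (oddIx p))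
ExposesEven U V ia ib p = (U (ia (suc (suc p))) ≡ U (evenIx p)) × (V (ib (suc p)) ≡ V (evenIx p))

module Criterion (r : ℕ) (U V : ℕ → ℤ) (U-anti : Antitone (2 * r) U) (V-anti : Antitone (2 * r) V) where
  open ℤ.≤-Reasoning

  -- (a) ⇒ (b): each comparison of β ≺ α is enclosed by an alternation of U and V.
  windowed-interlaces : ∀ {ia ib} → Alternating r U V → OuterWindow r ia → InnerWindow ib →
    Interlaces r (V ∘ ib) (U ∘ ia)
  windowed-interlaces {ia} {ib} (odd-below , even-above) outer inner p p<r
    with outer p p<r | inner p
  ... | (1≤a , a≤odd) , (even≤a′ , a′≤2r) | odd≤b , b≤even =
    (begin
      V (ib (suc p))       ≤⟨ antitone-≤ V-anti (s≤s z≤n) odd≤b (≤-trans b≤even (evenIx≤ p<r)) ⟩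
      V (oddIx p)          ≤⟨ odd-below p p<r ⟩
      U (oddIx p)          ≤⟨ antitone-≤ U-anti 1≤a a≤odd (oddIx≤ p<r) ⟩
      U (ia (suc p))       ∎)
    , (begin
      U (ia (suc (suc p))) ≤⟨ antitone-≤ U-anti (s≤s z≤n) even≤a′ a′≤2r ⟩
      U (evenIx p)         ≤⟨ even-above p p<r ⟩
      V (evenIx p)         ≤⟨ antitone-≤ V-anti (≤-trans (s≤s z≤n) odd≤b) b≤even (evenIx≤ p<r) ⟩
      V (ib (suc p))       ∎)

  exposed-odd : ∀ {ia ib p} → Interlaces r (V ∘ ib) (U ∘ ia) → p < r → ExposesOdd U V ia ib p →
    V (oddIx p) ≤ℤ U (oddIx p)
  exposed-odd I p<r (eqV , eqU) = subst₂ _≤ℤ_ eqV eqU (proj₁ (I _ p<r))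

  exposed-even : ∀ {ia ib p} → Interlaces r (V ∘ ib) (U ∘ ia) → p < r → ExposesEven U V ia ib p →
    U (evenIx p) ≤ℤ V (evenIx p)
  exposed-even I p<r (eqU , eqV) = subst₂ _≤ℤ_ eqU eqV (proj₂ (I _ p<r))

  alternating⇔interlaces : ∀ (ia₁ ib₁ ia₂ ib₂ : ℕ → ℕ) →
    OuterWindow r ia₁ → InnerWindow ib₁ → OuterWindow r ia₂ → InnerWindow ib₂ →
    (∀ p → p < r → ExposesOdd U V ia₁ ib₁ p ⊎ ExposesOdd U V ia₂ ib₂ p) →
    (∀ p → p < r → ExposesEven U V ia₁ ib₁ p ⊎ ExposesEven U V ia₂ ib₂ p) →
    Alternating r U V ⇔ (Interlaces r (V ∘ ib₁) (U ∘ ia₁) × Interlaces r (V ∘ ib₂) (U ∘ ia₂))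
  alternating⇔interlaces ia₁ ib₁ ia₂ ib₂ outer₁ inner₁ outer₂ inner₂ odd-exposed even-exposed = mk⇔
    (λ alt → windowed-interlaces {ia₁} {ib₁} alt outer₁ inner₁
           , windowed-interlaces {ia₂} {ib₂} alt outer₂ inner₂)
    (λ (I₁ , I₂) →
      (λ p p<r → [ exposed-odd {ia₁} {ib₁} I₁ p<r , exposed-odd {ia₂} {ib₂} I₂ p<r ] (odd-exposed p p<r))
      , (λ p p<r → [ exposed-even {ia₁} {ib₁} I₁ p<r , exposed-even {ia₂} {ib₂} I₂ p<r ] (even-exposed p p<r)))

if-≤ᵇ-yes : ∀ {A : Set} {m n} (a b : A) → m ≤ n → (if m ≤ᵇ n then a else b) ≡ a
if-≤ᵇ-yes {m = m} {n} a b m≤n with m ≤ᵇ n | ≤⇒≤ᵇ m≤n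
... | true  | _ = refl
... | false | ()

if-≤ᵇ-no : ∀ {A : Set} {m n} (a b : A) → n < m → (if m ≤ᵇ n then a else b) ≡ b
if-≤ᵇ-no {m = m} {n} a b n<m with m ≤ᵇ n | ≤ᵇ⇒≤ m n
... | false | _   = refl
... | true  | m≤n = contradiction (m≤n tt) (<⇒≱ n<m)

if-both : ∀ {A : Set} (P : A → Set) (c : Bool) {a b : A} → P a → P b → P (if c then a else b)
if-both P true  Pa _  = Pa
if-both P false _  Pb = Pb

-- The unprimed maps test k ≤ ⌊r/2⌋ + 1, i.e. p ≤ ⌊r/2⌋ for k = p+1.
≤⇒suc≤+1 : ∀ {p h} → p ≤ h → suc p ≤ h + 1
≤⇒suc≤+1 {p} {h} p≤h = subst (suc p ≤_) (+-comm 1 h) (s≤s p≤h)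

>⇒+1<suc : ∀ {p h} → h < p → h + 1 < suc p
>⇒+1<suc {p} {h} h<p = subst (_< suc p) (+-comm 1 h) (s≤s h<p)

module IndexMaps (r : ℕ) where
  H : ℕ
  H = ⌊ r /2⌋

  -- θ₁ (both parities; idxO1 is given by the same formula as idxE1)
  idxE1-double : ∀ p → 1 ≤ p → p ≤ H → idxE1 r (suc p) ≡ p + p
  idxE1-double (suc q) _ p≤H = trans (if-≤ᵇ-yes _ _ (≤⇒suc≤+1 p≤H)) (twice-suc∸2 (suc q))

  idxE1-even : ∀ p → suc p ≤ H → idxE1 r (suc (suc p)) ≡ evenIx p
  idxE1-even p p<H = trans (idxE1-double (suc p) (s≤s z≤n) p<H) (double-suc p)

  idxE1-odd : ∀ p → H < p → suc p ≤ r → idxE1 r (suc p) ≡ oddIx p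
  idxE1-odd (suc q) H<p p<r =
    trans (if-≤ᵇ-no _ _ (>⇒+1<suc H<p)) (trans (if-≤ᵇ-yes _ _ p<r) (twice-suc∸1 (suc q)))

  idxE1-last : ∀ p → H < p → r < suc p → idxE1 r (suc p) ≡ 2 * r
  idxE1-last (suc q) H<p r≤p = trans (if-≤ᵇ-no _ _ (>⇒+1<suc H<p)) (if-≤ᵇ-no _ _ r≤p)

  -- θ₂ (both parities; idxO2 is given by the same formula as idxE2)
  idxE2-odd : ∀ p → p ≤ H → idxE2 r (suc p) ≡ oddIx p
  idxE2-odd p p≤H = trans (if-≤ᵇ-yes _ _ (≤⇒suc≤+1 p≤H)) (twice-suc∸1 p)

  idxE2-double : ∀ p → H < p → idxE2 r (suc p) ≡ p + p
  idxE2-double p H<p = trans (if-≤ᵇ-no _ _ (>⇒+1<suc H<p)) (twice-suc∸2 p)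

  idxE2-even : ∀ p → H < suc p → idxE2 r (suc (suc p)) ≡ evenIx p
  idxE2-even p H<p = trans (idxE2-double (suc p) H<p) (double-suc p)

  idxE1'-even : ∀ p → suc p ≤ H → idxE1' r (suc p) ≡ evenIx p
  idxE1'-even p p<H = trans (if-≤ᵇ-yes _ _ p<H) (twice-suc p)

  idxE1'-odd : ∀ p → H < suc p → idxE1' r (suc p) ≡ oddIx p
  idxE1'-odd p H≤p = trans (if-≤ᵇ-no _ _ H≤p) (twice-suc∸1 p)

  idxE2'-odd : ∀ p → suc p ≤ H → idxE2' r (suc p) ≡ oddIx p
  idxE2'-odd p p<H = trans (if-≤ᵇ-yes _ _ p<H) (twice-suc∸1 p)

  idxE2'-even : ∀ p → H < suc p → idxE2' r (suc p) ≡ evenIx p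
  idxE2'-even p H≤p = trans (if-≤ᵇ-no _ _ H≤p) (twice-suc p)

  idxO1'-even : ∀ p → p ≤ H → idxO1' r (suc p) ≡ evenIx p
  idxO1'-even p p≤H = trans (if-≤ᵇ-yes _ _ (≤⇒suc≤+1 p≤H)) (twice-suc p)

  idxO1'-odd : ∀ p → H < p → idxO1' r (suc p) ≡ oddIx p
  idxO1'-odd p H<p = trans (if-≤ᵇ-no _ _ (>⇒+1<suc H<p)) (twice-suc∸1 p)

  idxO2'-odd : ∀ p → p ≤ H → idxO2' r (suc p) ≡ oddIx p
  idxO2'-odd p p≤H = trans (if-≤ᵇ-yes _ _ (≤⇒suc≤+1 p≤H)) (twice-suc∸1 p)

  idxO2'-even : ∀ p → H < p → idxO2' r (suc p) ≡ evenIx p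
  idxO2'-even p H<p = trans (if-≤ᵇ-no _ _ (>⇒+1<suc H<p)) (twice-suc p)

  half-room : ∀ p → suc p ≤ H → suc p < r
  half-room p p<H = begin
    suc (suc p)     ≤⟨ s≤s (m≤n+m (suc p) p) ⟩
    suc p + suc p   ≤⟨ +-mono-≤ p<H (≤-trans p<H (⌊n/2⌋≤⌈n/2⌉ r)) ⟩
    H + ⌈ r /2⌉     ≡⟨ ⌊n/2⌋+⌈n/2⌉≡n r ⟩
    r               ∎
    where open ≤-Reasoning

  θ₁-lower : ∀ p → p < r → (1 ≤ idxE1 r (suc p)) × (idxE1 r (suc p) ≤ oddIx p)
  θ₁-lower zero    _   = s≤s z≤n , s≤s z≤n
  θ₁-lower (suc q) p<r with suc q ≤? H
  ... | yes p≤H rewrite idxE1-double (suc q) (s≤s z≤n) p≤H = s≤s z≤n , n≤1+n _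
  ... | no  p≰H rewrite idxE1-odd (suc q) (≰⇒> p≰H) p<r    = s≤s z≤n , ≤-refl

  θ₁-upper : ∀ p → p < r → (evenIx p ≤ idxE1 r (suc (suc p))) × (idxE1 r (suc (suc p)) ≤ 2 * r)
  θ₁-upper p p<r with suc p ≤? H | suc (suc p) ≤? r
  ... | yes p<H | _ rewrite idxE1-even p p<H = ≤-refl , evenIx≤ p<r
  ... | no  p≮H | yes p+1<r rewrite idxE1-odd (suc p) (≰⇒> p≮H) p+1<r =
    <⇒≤ (evenIx<oddIx-suc p) , oddIx≤ p+1<r
  ... | no  p≮H | no  p+1≮r rewrite idxE1-last (suc p) (≰⇒> p≮H) (≰⇒> p+1≮r) = evenIx≤ p<r , ≤-refl

  θ₂-lower : ∀ p → (1 ≤ idxE2 r (suc p)) × (idxE2 r (suc p) ≤ oddIx p)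
  θ₂-lower p with p ≤? H
  ... | yes p≤H rewrite idxE2-odd p p≤H = s≤s z≤n , ≤-refl
  ... | no  p≰H rewrite idxE2-double p (≰⇒> p≰H) =
    ≤-trans (≤-trans (s≤s z≤n) (≰⇒> p≰H)) (m≤m+n p p) , n≤1+n _

  θ₂-upper : ∀ p → p < r → (evenIx p ≤ idxE2 r (suc (suc p))) × (idxE2 r (suc (suc p)) ≤ 2 * r)
  θ₂-upper p p<r with suc p ≤? H
  ... | yes p<H rewrite idxE2-odd (suc p) p<H = <⇒≤ (evenIx<oddIx-suc p) , oddIx≤ (half-room p p<H)
  ... | no  p≮H rewrite idxE2-even p (≰⇒> p≮H) = ≤-refl , evenIx≤ p<r

  outer-θ₁ : OuterWindow r (idxE1 r)
  outer-θ₁ p p<r = θ₁-lower p p<r , θ₁-upper p p<r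

  outer-θ₂ : OuterWindow r (idxE2 r)
  outer-θ₂ p p<r = θ₂-lower p , θ₂-upper p p<r

  inner-E1' : InnerWindow (idxE1' r)
  inner-E1' p = if-both (Between p) (suc p ≤ᵇ H) (even-between p) (odd-between p)

  inner-E2' : InnerWindow (idxE2' r)
  inner-E2' p = if-both (Between p) (suc p ≤ᵇ H) (odd-between p) (even-between p)

  inner-O1' : InnerWindow (idxO1' r)
  inner-O1' p = if-both (Between p) (suc p ≤ᵇ H + 1) (even-between p) (odd-between p)

  inner-O2' : InnerWindow (idxO2' r)
  inner-O2' p = if-both (Between p) (suc p ≤ᵇ H + 1) (odd-between p) (even-between p)

-- r even: U is the symplectic vector, whose middle equality serves the odd pair p = r/2.
module EvenExposure (r : ℕ) (U V : ℕ → ℤ) (r≡H+H : r ≡ ⌊ r /2⌋ + ⌊ r /2⌋) (1≤H : 1 ≤ ⌊ r /2⌋)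
                    (U-mid : U r ≡ U (suc r)) where
  open IndexMaps r
  open ≡-Reasoning

  middle-odd : U (idxE1 r (suc H)) ≡ U (oddIx H)
  middle-odd = begin
    U (idxE1 r (suc H))  ≡⟨ cong U (idxE1-double H 1≤H ≤-refl) ⟩
    U (H + H)            ≡⟨ cong U (sym r≡H+H) ⟩
    U r                  ≡⟨ U-mid ⟩
    U (suc r)            ≡⟨ cong (U ∘ suc) r≡H+H ⟩
    U (oddIx H)          ∎

  odd-exposed : ∀ p → p < r →
    ExposesOdd U V (idxE1 r) (idxE1' r) p ⊎ ExposesOdd U V (idxE2 r) (idxE2' r) p
  odd-exposed p p<r with <-cmp p H
  ... | tri< p<H _ _  = inj₂ (cong V (idxE2'-odd p p<H) , cong U (idxE2-odd p (<⇒≤ p<H)))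
  ... | tri≈ _ refl _ = inj₁ (cong V (idxE1'-odd p (n<1+n p)) , middle-odd)
  ... | tri> _ _ H<p  = inj₁ (cong V (idxE1'-odd p (m<n⇒m<1+n H<p)) , cong U (idxE1-odd p H<p p<r))

  even-exposed : ∀ p → p < r →
    ExposesEven U V (idxE1 r) (idxE1' r) p ⊎ ExposesEven U V (idxE2 r) (idxE2' r) p
  even-exposed p _ with suc p ≤? H
  ... | yes p<H = inj₁ (cong U (idxE1-even p p<H) , cong V (idxE1'-even p p<H))
  ... | no  p≮H = inj₂ (cong U (idxE2-even p (≰⇒> p≮H)) , cong V (idxE2'-even p (≰⇒> p≮H)))

-- r odd: V is the symplectic vector, whose middle equality serves the even pair p = (r-1)/2.
module OddExposure (r : ℕ) (U V : ℕ → ℤ) (r≡1+H+H : r ≡ suc (⌊ r /2⌋ + ⌊ r /2⌋))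
                   (V-mid : V r ≡ V (suc r)) where
  open IndexMaps r
  open ≡-Reasoning

  middle-even : V (idxO2' r (suc H)) ≡ V (evenIx H)
  middle-even = begin
    V (idxO2' r (suc H)) ≡⟨ cong V (idxO2'-odd H ≤-refl) ⟩
    V (oddIx H)          ≡⟨ cong V (sym r≡1+H+H) ⟩
    V r                  ≡⟨ V-mid ⟩
    V (suc r)            ≡⟨ cong (V ∘ suc) r≡1+H+H ⟩
    V (evenIx H)         ∎

  odd-exposed : ∀ p → p < r →
    ExposesOdd U V (idxO1 r) (idxO1' r) p ⊎ ExposesOdd U V (idxO2 r) (idxO2' r) p
  odd-exposed p p<r with p ≤? H
  ... | yes p≤H = inj₂ (cong V (idxO2'-odd p p≤H) , cong U (idxE2-odd p p≤H))
  ... | no  p≰H = inj₁ (cong V (idxO1'-odd p (≰⇒> p≰H)) , cong U (idxE1-odd p (≰⇒> p≰H) p<r))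

  even-exposed : ∀ p → p < r →
    ExposesEven U V (idxO1 r) (idxO1' r) p ⊎ ExposesEven U V (idxO2 r) (idxO2' r) p
  even-exposed p _ with <-cmp p H
  ... | tri< p<H _ _  = inj₁ (cong U (idxE1-even p p<H) , cong V (idxO1'-even p (<⇒≤ p<H)))
  ... | tri≈ _ refl _ = inj₂ (cong U (idxE2-even p (n<1+n p)) , middle-even)
  ... | tri> _ _ H<p  = inj₂ (cong U (idxE2-even p (m<n⇒m<1+n H<p)) , cong V (idxO2'-even p H<p))

InterlacedAt : ∀ {n} → (u v : Fin n → ℤ) → ℕ → Set
InterlacedAt u v k = (v ! (k ∸ 1) ≤ℤ u ! (k ∸ 1)) × (v ! k ≤ℤ v ! (k ∸ 1)) × (u ! k ≤ℤ v ! k)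

-- For non-increasing v the middle inequalities of (a) hold automatically, so
-- (a) for (u, v) is the alternation of u and v.
interlaced⇔alternating : ∀ r (u v : Fin (2 * r) → ℤ) → Antitone (2 * r) (v !_) →
  Interlaced r u v ⇔ Alternating r (u !_) (v !_)
interlaced⇔alternating r u v v-anti = mk⇔ to from
  where
  clause : Interlaced r u v → ∀ p → p < r → InterlacedAt u v (evenIx p)
  clause I p p<r = subst (InterlacedAt u v) (twice-suc p) (I (suc p) (s≤s z≤n) p<r)

  to : Interlaced r u v → Alternating r (u !_) (v !_)
  to I = (λ p p<r → proj₁ (clause I p p<r)) , (λ p p<r → proj₂ (proj₂ (clause I p p<r)))

  from : Alternating r (u !_) (v !_) → Interlaced r u v
  from (odd-below , even-above) (suc p) _ p<r = subst (InterlacedAt u v) (sym (twice-suc p))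
    (odd-below p p<r , v-anti (oddIx p) (s≤s z≤n) (evenIx≤ p<r) , even-above p p<r)

!-tabulate : ∀ {m} (g : ℕ → ℤ) i → i < m → (λ (k : Fin m) → g (suc (toℕ k))) ! suc i ≡ g (suc i)
!-tabulate {suc m} g zero    _         = refl
!-tabulate {suc m} g (suc i) (s≤s i<m) = !-tabulate {m} (g ∘ suc) i i<m

≺-select⇔ : ∀ {m n n′} (ib ia : ℕ → ℕ) (x : Fin n → ℤ) (w : Fin n′ → ℤ) →
  (select m ib x ≺ select (suc m) ia w) ⇔ Interlaces m ((x !_) ∘ ib) ((w !_) ∘ ia)
≺-select⇔ {m} ib ia x w = mk⇔ to from
  where
  β! : ∀ i → i < m → select m ib x ! suc i ≡ x ! ib (suc i)
  β! = !-tabulate (λ j → x ! ib j)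

  α! : ∀ i → i < suc m → select (suc m) ia w ! suc i ≡ w ! ia (suc i)
  α! = !-tabulate (λ j → w ! ia j)

  to : select m ib x ≺ select (suc m) ia w → Interlaces m ((x !_) ∘ ib) ((w !_) ∘ ia)
  to h p p<m with h (suc p) (s≤s z≤n) p<m
  ... | β≤α , α≤β = subst₂ _≤ℤ_ (β! p p<m) (α! p (m<n⇒m<1+n p<m)) β≤α
                  , subst₂ _≤ℤ_ (α! (suc p) (s≤s p<m)) (β! p p<m) α≤β

  from : Interlaces m ((x !_) ∘ ib) ((w !_) ∘ ia) → select m ib x ≺ select (suc m) ia w
  from I (suc p) _ p<m with I p p<m
  ... | β≤α , α≤β = subst₂ _≤ℤ_ (sym (β! p p<m)) (sym (α! p (m<n⇒m<1+n p<m))) β≤α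
                  , subst₂ _≤ℤ_ (sym (α! (suc p) (s≤s p<m))) (sym (β! p p<m)) α≤β

≺-cong : ∀ {m} {β β′ : Fin m → ℤ} {α α′ : Fin (suc m) → ℤ} → β ≡ β′ → α ≡ α′ → (β ≺ α) ⇔ (β′ ≺ α′)
≺-cong refl refl = mk⇔ (λ h → h) (λ h → h)

if-even : ∀ {A : Set} r {a b : A} → r % 2 ≡ 0 → (if r % 2 ≡ᵇ 0 then a else b) ≡ a
if-even r e rewrite e = refl

if-odd : ∀ {A : Set} r {a b : A} → r % 2 ≡ 1 → (if r % 2 ≡ᵇ 0 then a else b) ≡ b
if-odd r e rewrite e = refl

branching-even : ∀ r (y z : Fin (2 * r) → ℤ) → r % 2 ≡ 0 →
  ((θ₁' r z ≺ θ₁ r y) × (θ₂' r z ≺ θ₂ r y)) ⇔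
  (Interlaces r ((z !_) ∘ idxE1' r) ((y !_) ∘ idxE1 r) × Interlaces r ((z !_) ∘ idxE2' r) ((y !_) ∘ idxE2 r))
branching-even r y z e =
  (≺-select⇔ (idxE1' r) (idxE1 r) z y ⇔-∘ ≺-cong (if-even r e) (if-even r e))
  ×-⇔ (≺-select⇔ (idxE2' r) (idxE2 r) z y ⇔-∘ ≺-cong (if-even r e) (if-even r e))

branching-odd : ∀ r (y z : Fin (2 * r) → ℤ) → r % 2 ≡ 1 →
  ((θ₁' r y ≺ θ₁ r z) × (θ₂' r y ≺ θ₂ r z)) ⇔
  (Interlaces r ((y !_) ∘ idxO1' r) ((z !_) ∘ idxO1 r) × Interlaces r ((y !_) ∘ idxO2' r) ((z !_) ∘ idxO2 r))
branching-odd r y z e =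
  (≺-select⇔ (idxO1' r) (idxO1 r) y z ⇔-∘ ≺-cong (if-odd r e) (if-odd r e))
  ×-⇔ (≺-select⇔ (idxO2' r) (idxO2 r) y z ⇔-∘ ≺-cong (if-odd r e) (if-odd r e))

proposition4p1 : (r : ℕ) → 1 ≤ r → (y z : Fin (2 * r) → ℤ) → Xsp r y → X0+ r z →
    (r % 2 ≡ 0 → Interlaced r y z ⇔ ((θ₁' r z ≺ θ₁ r y) × (θ₂' r z ≺ θ₂ r y)))
    × (r % 2 ≡ 1 → Interlaced r z y ⇔ ((θ₁' r y ≺ θ₁ r z) × (θ₂' r y ≺ θ₂ r z)))
proposition4p1 r 1≤r y z ((y-anti , _) , y-mid) (z-anti , _) = even-case , odd-case
  where
  -- outer-θ₁, outer-θ₂ serve both parities: idxO1, idxO2 have the formulas of idxE1, idxE2.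
  open IndexMaps r using (outer-θ₁; outer-θ₂; inner-E1'; inner-E2'; inner-O1'; inner-O2')

  y-mid′ : y ! r ≡ y ! suc r
  y-mid′ = trans y-mid (cong (y !_) (+-comm r 1))

  even-case : r % 2 ≡ 0 → Interlaced r y z ⇔ ((θ₁' r z ≺ θ₁ r y) × (θ₂' r z ≺ θ₂ r y))
  even-case e = Equiv.sym (branching-even r y z e)
    ⇔-∘ (alternating⇔interlaces (idxE1 r) (idxE1' r) (idxE2 r) (idxE2' r)
           outer-θ₁ inner-E1' outer-θ₂ inner-E2' odd-exposed even-exposed
    ⇔-∘ interlaced⇔alternating r y z z-anti)
    where
    open Criterion r (y !_) (z !_) y-anti z-anti
    open EvenExposure r (y !_) (z !_) (even-split r e) (half-positive 1≤r (even-split r e)) y-mid′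

  odd-case : r % 2 ≡ 1 → Interlaced r z y ⇔ ((θ₁' r y ≺ θ₁ r z) × (θ₂' r y ≺ θ₂ r z))
  odd-case e = Equiv.sym (branching-odd r y z e)
    ⇔-∘ (alternating⇔interlaces (idxO1 r) (idxO1' r) (idxO2 r) (idxO2' r)
           outer-θ₁ inner-O1' outer-θ₂ inner-O2' odd-exposed even-exposed
    ⇔-∘ interlaced⇔alternating r z y y-anti)
    where
    open Criterion r (z !_) (y !_) z-anti y-anti
    open OddExposure r (z !_) (y !_) (odd-split r e) y-mid′
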